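{- Let $M \ge 2$, $N \ge 1$, $p \ge 0$ be integers with $\operatorname{rad}(M) \nmid \operatorname{rad}(N)$, let $\xi$ be a primitive $M$-th root of unity, and let $(\beta_k^{(p)})_{k\ge0}$ be defined by $\sum_{k\ge 0}\beta_k^{(p)} z^k = G_p(z)/(1-z)^{p+1}$, where $G_p(z)=\sum_{m=0}^{M^{p+1}-1}\xi^{\mathcal{B}_{M,N}(m)}z^m$. Then $(\beta_k^{(p)})$ has finite support, and (i) $\displaystyle\sum_{k \ge 0} \beta_k^{(p)} = M^{\frac{(p+1)(p+2)}{2}} \prod_{l=0}^{p} \frac{1}{1-\xi^{N^l}}$; (ii) $\displaystyle\sum_{k \ge 0} k\,\beta_k^{(p)} = \Big(\sum_{k \ge 0} \beta_k^{(p)}\Big) \cdot \sum_{l=0}^{p} \left( \frac{M^{l+1}-1}{2} + \frac{M^l \xi^{N^l}}{1-\xi^{N^l}} \right)$.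
   Context: For integers $M\ge 2$, $N \ge 1$ and $n\ge 0$ with base-$M$ expansion $n=\sum_{i\ge 0} d_i(n) M^i$, $d_i(n)\in\{0,\dots,M-1\}$, the base-shifting map is $\mathcal{B}_{M,N}(n) := \sum_{i\ge 0} d_i(n) N^i$. $\operatorname{rad}(k)$ is the product of the distinct prime factors of $k$. Under the hypothesis, $G_p(z)$ is divisible by $(1-z)^{p+1}$, so the quotient is a polynomial. -}

module Defs where

open import Level using (Level; _⊔_) renaming (suc to lsuc)
open import Data.Nat as ℕ using (ℕ; zero; suc; _%_; _/_; _<?_)
open import Data.Nat.Divisibility using (_∣_; _∣?_)
open import Data.Nat.Primality using (Prime; prime?)
open import Data.Nat.Combinatorics using (_C_)
open import Data.List using (List; filter; upTo)
open import Data.Nat.ListAction using (product)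
open import Relation.Nullary using (¬_; yes; no)
open import Relation.Nullary.Decidable using (_×-dec_)
open import Algebra.Bundles using (CommutativeRing)

rad : ℕ → ℕ
rad n = product (filter (λ q → prime? q ×-dec q ∣? n) (upTo (suc n)))

-- Base shifting map B_{M,N}(n) = Σ d_i(n) N^i, where n = Σ d_i(n) M^i.
-- Implemented with fuel (n digits always suffice when M ≥ 2).

Bfuel : ℕ → ℕ → ℕ → ℕ → ℕ
Bfuel (suc k) N (suc f) n = n % suc k ℕ.+ N ℕ.* Bfuel (suc k) N f (n / suc k)
Bfuel _       _ _       _ = 0

B : ℕ → ℕ → ℕ → ℕ
B M N n = Bfuel M N n n

record Field (c ℓ : Level) : Set (lsuc (c ⊔ ℓ)) where
  field
    commutativeRing : CommutativeRing c ℓ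
  open CommutativeRing commutativeRing public
  field
    _⁻¹       : Carrier → Carrier
    ⁻¹-cong   : ∀ {x y} → x ≈ y → x ⁻¹ ≈ y ⁻¹
    inverse   : ∀ x → ¬ (x ≈ 0#) → x * x ⁻¹ ≈ 1#
    zero⁻¹    : 0# ⁻¹ ≈ 0#
    0≉1       : ¬ (0# ≈ 1#)

module FieldDefs {c ℓ : Level} (F : Field c ℓ) where
  open Field F

  infixl 7 _÷_
  _÷_ : Carrier → Carrier → Carrier
  x ÷ y = x * y ⁻¹

  fromℕ : ℕ → Carrier
  fromℕ zero    = 0#
  fromℕ (suc n) = 1# + fromℕ n

  infixr 8 _^_
  _^_ : Carrier → ℕ → Carrier
  x ^ zero  = 1#
  x ^ suc n = x * (x ^ n)

  Σ< : ℕ → (ℕ → Carrier) → Carrier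
  Σ< zero    f = 0#
  Σ< (suc n) f = Σ< n f + f n

  Π< : ℕ → (ℕ → Carrier) → Carrier
  Π< zero    f = 1#
  Π< (suc n) f = Π< n f * f n

  CharZero : Set ℓ
  CharZero = ∀ n → ¬ (fromℕ (suc n) ≈ 0#)

  PrimitiveRoot : ℕ → Carrier → Set ℓ
  PrimitiveRoot M ξ = (ξ ^ M ≈ 1#) × (∀ d → 0 ℕ.< d → d ℕ.< M → ¬ (ξ ^ d ≈ 1#))
    where open import Data.Product using (_×_)

  gCoeff : (M N p : ℕ) (ξ : Carrier) → ℕ → Carrier
  gCoeff M N p ξ m with m <? M ℕ.^ suc p
  ... | yes _ = ξ ^ B M N m
  ... | no  _ = 0#

  -- β_k^{(p)}: coefficients of the power series G_p(z) / (1-z)^{p+1},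
  -- using 1/(1-z)^{p+1} = Σ_j C(j+p, p) z^j (Cauchy product).
  β : (M N p : ℕ) (ξ : Carrier) → ℕ → Carrier
  β M N p ξ k = Σ< (suc k) (λ m → gCoeff M N p ξ m * fromℕ ((k ℕ.∸ m ℕ.+ p) C p))

-- Grouping m < M^(n+1) by its leading base-M digit j gives G_(n+1)(z) = G_n(z) Σ_{j<M} (ζ_n z^(M^n))^j
-- with ζ_n = ξ^(N^n), and ζ_n ≠ 1 because rad M ∤ rad N. As 1 + ζ + ⋯ + ζ^(M-1) = 0, each factor
-- Σ_{j<M} (ζ z^L)^j equals (1 - z) h(z), where h repeats each partial sum 1 + ζ + ⋯ + ζ^j L times.
-- So G_p(z)/(1 - z)^(p+1) is the polynomial ∏_{l≤p} h_l(z): Σ β_k and Σ k β_k are its value and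
-- derivative at 1, and these follow from h_l(1) = M^(l+1)/(1 - ζ_l) and
-- h_l′(1)/h_l(1) = (M^(l+1) - 1)/2 + M^l ζ_l/(1 - ζ_l).

module Submission where

open import Defs
open import Level using (Level)
open import Data.Nat as ℕ using (ℕ; suc; _≤_)
open import Data.Nat.Divisibility using (_∣_)
open import Data.Product using (∃; _×_; _,_; proj₁)
open import Relation.Nullary using (¬_)

module BaseShift (k N : ℕ) where
  open import Data.Nat using (zero; _<_; _+_; _*_; _^_; _%_; _/_; z≤n; s≤s)
  open import Data.Nat.Properties
  open import Data.Nat.DivMod
  open import Data.Nat.Divisibility using (divides)
  open import Data.Nat.Tactic.RingSolver using (solve; solve-∀)
  open import Data.List using ([]; _∷_)
  open import Relation.Binary.PropositionalEquality
  open ≡-Reasoning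

  M : ℕ
  M = 2 + k

  Bfuel-zero : ∀ f → Bfuel M N f 0 ≡ 0
  Bfuel-zero zero    = refl
  Bfuel-zero (suc f) = trans (cong (N *_) (Bfuel-zero f)) (*-zeroʳ N)

  [1+m]/M≤m : ∀ m → suc m / M ≤ m
  [1+m]/M≤m m = <⇒≤pred (m/n<m (suc m) M (s≤s (s≤s z≤n)))

  Bfuel-fuel-irrelevant : ∀ {f f′} n → n ≤ f → n ≤ f′ → Bfuel M N f n ≡ Bfuel M N f′ n
  Bfuel-fuel-irrelevant {f} {f′} zero _ _ = trans (Bfuel-zero f) (sym (Bfuel-zero f′))
  Bfuel-fuel-irrelevant {suc f} {suc f′} (suc n) (s≤s n≤f) (s≤s n≤f′) =
    cong (λ b → suc n % M + N * b)
      (Bfuel-fuel-irrelevant (suc n / M) (≤-trans ([1+m]/M≤m n) n≤f) (≤-trans ([1+m]/M≤m n) n≤f′))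

  B-step : ∀ m → B M N m ≡ m % M + N * B M N (m / M)
  B-step zero    = sym (*-zeroʳ N)
  B-step (suc m) = cong (λ b → suc m % M + N * b)
    (Bfuel-fuel-irrelevant (suc m / M) ([1+m]/M≤m m) ≤-refl)

  B-leading-digit : ∀ n {j r} → r < M ^ n → j < M →
                    B M N (j * M ^ n + r) ≡ B M N r + j * N ^ n
  B-leading-digit zero {j} {zero} _ j<M = begin
    B M N (j * 1 + 0)          ≡⟨ cong (B M N) (trans (+-identityʳ _) (*-identityʳ j)) ⟩
    B M N j                    ≡⟨ B-step j ⟩
    j % M + N * B M N (j / M)  ≡⟨ cong₂ (λ a b → a + N * B M N b) (m<n⇒m%n≡m j<M) (m<n⇒m/n≡0 j<M) ⟩
    j + N * 0                  ≡⟨ solve (j ∷ N ∷ []) ⟩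
    0 + j * 1                  ∎
  B-leading-digit zero {r = suc _} (s≤s ()) _
  B-leading-digit (suc n) {j} {r} r<M^1+n j<M = begin
    B M N (j * (M * L) + r)                  ≡⟨ cong (B M N) (rearrange j M L r) ⟩
    B M N (r + j * L * M)                    ≡⟨ B-step (r + j * L * M) ⟩
    (r + j * L * M) % M + N * B M N ((r + j * L * M) / M)
      ≡⟨ cong₂ (λ a b → a + N * B M N b) ([m+kn]%n≡m%n r (j * L) M) quotient ⟩
    r % M + N * B M N (j * L + r / M)        ≡⟨ cong (λ b → r % M + N * b) (B-leading-digit n r/M<L j<M) ⟩
    r % M + N * (B M N (r / M) + j * N ^ n)  ≡⟨ regroup (r % M) N (B M N (r / M)) j (N ^ n) ⟩
    (r % M + N * B M N (r / M)) + j * (N * N ^ n)  ≡⟨ cong (_+ j * (N * N ^ n)) (B-step r) ⟨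
    B M N r + j * (N * N ^ n)                ∎
    where
    L = M ^ n
    rearrange : ∀ a b c d → a * (b * c) + d ≡ d + a * c * b
    rearrange = solve-∀
    regroup : ∀ a b c d e → a + b * (c + d * e) ≡ (a + b * c) + d * (b * e)
    regroup = solve-∀
    quotient : (r + j * L * M) / M ≡ j * L + r / M
    quotient = trans (+-distrib-/-∣ʳ r (divides (j * L) refl))
                     (trans (cong (r / M +_) (m*n/n≡m (j * L) M)) (+-comm (r / M) (j * L)))
    r/M<L : r / M < L
    r/M<L = m<n*o⇒m/o<n (subst (r <_) (*-comm M L) r<M^1+n)

module Radical where
  open import Data.Nat using (zero; _+_; _*_; _^_)
  open import Data.Nat.Properties
  open import Data.Nat.Divisibility
  open import Data.Nat.Primality using (Prime; prime?; euclidsLemma)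
  open import Data.Nat.ListAction using (product)
  open import Data.Nat.ListAction.Properties using (product-++)
  open import Data.List using ([]; _∷_; filter; upTo; _++_)
  open import Data.List.Properties using (upTo-∷ʳ; filter-++; filter-accept; filter-reject)
  open import Data.Sum using (inj₁; inj₂)
  open import Relation.Nullary using (Dec; yes; no)
  open import Relation.Nullary.Decidable using (_×-dec_)
  open import Relation.Binary.PropositionalEquality

  PrimeDivisorOf : ℕ → ℕ → Set
  PrimeDivisorOf n q = Prime q × q ∣ n

  primeDivisorOf? : ∀ n q → Dec (PrimeDivisorOf n q)
  primeDivisorOf? n q = prime? q ×-dec q ∣? n

  radBelow : ℕ → ℕ → ℕ
  radBelow n k = product (filter (primeDivisorOf? n) (upTo k))

  factorAt : ℕ → ℕ → ℕ
  factorAt n k = product (filter (primeDivisorOf? n) (k ∷ []))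

  radBelow-suc : ∀ n k → radBelow n (suc k) ≡ radBelow n k * factorAt n k
  radBelow-suc n k = begin
    product (filter P? (upTo (suc k)))                   ≡⟨ cong (λ xs → product (filter P? xs)) (upTo-∷ʳ k) ⟨
    product (filter P? (upTo k ++ k ∷ []))               ≡⟨ cong product (filter-++ P? (upTo k) (k ∷ [])) ⟩
    product (filter P? (upTo k) ++ filter P? (k ∷ []))   ≡⟨ product-++ (filter P? (upTo k)) _ ⟩
    radBelow n k * factorAt n k                          ∎
    where P? = primeDivisorOf? n
          open ≡-Reasoning

  factorAt-∣ : ∀ {m n} k → (PrimeDivisorOf m k → PrimeDivisorOf n k) → factorAt m k ∣ factorAt n k
  factorAt-∣ {m} {n} k m⇒n with primeDivisorOf? m k
  ... | no ¬pm rewrite filter-reject (primeDivisorOf? m) {xs = []} ¬pm = 1∣ _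
  ... | yes pm rewrite filter-accept (primeDivisorOf? m) {xs = []} pm
                     | filter-accept (primeDivisorOf? n) {xs = []} (m⇒n pm) = ∣-refl

  radBelow-∣ : ∀ {m n} → (∀ q → PrimeDivisorOf m q → PrimeDivisorOf n q) →
               ∀ k → radBelow m k ∣ radBelow n k
  radBelow-∣ m⇒n zero    = ∣-refl
  radBelow-∣ {m} {n} m⇒n (suc k) rewrite radBelow-suc m k | radBelow-suc n k =
    *-pres-∣ (radBelow-∣ m⇒n k) (factorAt-∣ k (m⇒n k))

  radBelow-∣-extend : ∀ n k j → radBelow n k ∣ radBelow n (j + k)
  radBelow-∣-extend n k zero    = ∣-refl
  radBelow-∣-extend n k (suc j) rewrite radBelow-suc n (j + k) =
    ∣-trans (radBelow-∣-extend n k j) (m∣m*n _)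

  beyond-not-primeDivisor : ∀ n j → ¬ PrimeDivisorOf (suc n) (j + suc (suc n))
  beyond-not-primeDivisor n j (_ , d) = <-irrefl refl (≤-trans (m≤n+m (suc (suc n)) j) (∣⇒≤ d))

  radBelow-beyond : ∀ n j → radBelow (suc n) (j + suc (suc n)) ≡ rad (suc n)
  radBelow-beyond n zero    = refl
  radBelow-beyond n (suc j) = begin
    radBelow (suc n) (suc j + suc (suc n))      ≡⟨ radBelow-suc (suc n) (j + suc (suc n)) ⟩
    radBelow (suc n) (j + suc (suc n)) * factorAt (suc n) (j + suc (suc n))
      ≡⟨ cong (λ xs → radBelow (suc n) (j + suc (suc n)) * product xs) (filter-reject (primeDivisorOf? (suc n)) {xs = []} (beyond-not-primeDivisor n j)) ⟩
    radBelow (suc n) (j + suc (suc n)) * 1      ≡⟨ *-identityʳ _ ⟩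
    radBelow (suc n) (j + suc (suc n))          ≡⟨ radBelow-beyond n j ⟩
    rad (suc n)                                 ∎
    where open ≡-Reasoning

  prime∣^⇒∣ : ∀ {q} m e → Prime q → q ∣ m ^ e → q ∣ m
  prime∣^⇒∣ m zero    pq q∣1 with ∣1⇒≡1 q∣1 | pq
  ... | refl | ()
  prime∣^⇒∣ m (suc e) pq q∣m^1+e with euclidsLemma m (m ^ e) pq q∣m^1+e
  ... | inj₁ q∣m  = q∣m
  ... | inj₂ q∣m^e = prime∣^⇒∣ m e pq q∣m^e

  ∣^⇒rad∣rad : ∀ {m n} e → 1 ≤ n → m ∣ n ^ e → rad m ∣ rad n
  ∣^⇒rad∣rad {m} {suc n} e _ m∣n^e = begin
    radBelow m (suc m)                          ∣⟨ radBelow-∣ m⇒n (suc m) ⟩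
    radBelow (suc n) (suc m)                    ∣⟨ radBelow-∣-extend (suc n) (suc m) (suc (suc n)) ⟩
    radBelow (suc n) (suc (suc n) + suc m)      ≡⟨ cong (radBelow (suc n)) (+-comm (suc (suc n)) (suc m)) ⟩
    radBelow (suc n) (suc m + suc (suc n))      ≡⟨ radBelow-beyond n (suc m) ⟩
    rad (suc n)                                 ∎
    where
    open ∣-Reasoning
    m⇒n : ∀ q → PrimeDivisorOf m q → PrimeDivisorOf (suc n) q
    m⇒n q (pq , q∣m) = pq , prime∣^⇒∣ (suc n) e pq (∣-trans q∣m m∣n^e)

module Triangular where
  open import Data.Nat using (zero; _+_; _*_; _/_)
  open import Data.Nat.Properties using (*-distribʳ-+)
  open import Data.Nat.DivMod using (m*n/n≡m)
  open import Data.Nat.Tactic.RingSolver using (solve)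
  open import Data.List using ([]; _∷_)
  open import Relation.Binary.PropositionalEquality
  open ≡-Reasoning

  triangular : ℕ → ℕ
  triangular zero    = 0
  triangular (suc n) = triangular n + suc n

  triangular*2 : ∀ n → triangular n * 2 ≡ n * (n + 1)
  triangular*2 zero    = refl
  triangular*2 (suc n) = begin
    (triangular n + suc n) * 2    ≡⟨ *-distribʳ-+ 2 (triangular n) (suc n) ⟩
    triangular n * 2 + suc n * 2  ≡⟨ cong (_+ suc n * 2) (triangular*2 n) ⟩
    n * (n + 1) + suc n * 2       ≡⟨ solve (n ∷ []) ⟩
    suc n * (suc n + 1)           ∎

  triangular-closed : ∀ p → triangular (suc p) ≡ ((p + 1) * (p + 2)) / 2
  triangular-closed p = begin
    triangular (suc p)             ≡⟨ m*n/n≡m (triangular (suc p)) 2 ⟨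
    triangular (suc p) * 2 / 2     ≡⟨ cong (_/ 2) (triangular*2 (suc p)) ⟩
    suc p * (suc p + 1) / 2        ≡⟨ cong (_/ 2) shape ⟩
    (p + 1) * (p + 2) / 2          ∎
    where
    shape : suc p * (suc p + 1) ≡ (p + 1) * (p + 2)
    shape = solve (p ∷ [])

module OverField {c ℓ : Level} (F : Field c ℓ) where
  open Field F
  open FieldDefs F
  open Triangular using (triangular; triangular-closed)
  open import Data.Nat using (zero; _∸_; _<_; _%_; _/_; s≤s)
  import Data.Nat.Properties as ℕₚ
  open import Data.Sum using (inj₁; inj₂)
  open import Data.Empty using (⊥-elim)
  open import Data.Nat.DivMod using (m%n<n; m≡m%n+[m/n]*n; m<n*o⇒m/o<n)
  open import Data.Nat.Divisibility using (m%n≡0⇒n∣m)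
  open import Data.List using (List; []; _∷_; _++_; map; replicate; length)
  open import Data.List.Properties using (length-++; length-map; length-replicate)
  open import Data.Nat.Combinatorics using (_C_; nCn≡1; nCk+nC[k+1]≡[n+1]C[k+1])
  open import Data.Maybe using (Maybe; just; nothing)
  open import Relation.Nullary using (¬_; yes; no)
  open import Relation.Binary.PropositionalEquality as ≡ using (_≡_)
  open import Relation.Binary.Reasoning.Setoid setoid
  open import Algebra.Bundles using (RawRing)
  open import Algebra.Solver.Ring.AlmostCommutativeRing
    using (_-Raw-AlmostCommutative⟶_; fromCommutativeRing)
  import Algebra.Solver.Ring as RingSolver
  import Algebra.Solver.CommutativeMonoid as +-Solver
  open import Algebra.Properties.Ring ring using (-‿distribˡ-*; -‿distribʳ-*; -‿involutive; -0#≈0#)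
  open import Algebra.Properties.AbelianGroup +-abelianGroup using (⁻¹-∙-comm; ⁻¹-anti-homo‿-)
  open +-Solver +-commutativeMonoid using (_⊕_; _⊜_) renaming (solve to +-solve)

  fromℕ-+ : ∀ a b → fromℕ (a ℕ.+ b) ≈ fromℕ a + fromℕ b
  fromℕ-+ zero    b = sym (+-identityˡ _)
  fromℕ-+ (suc a) b = trans (+-congˡ (fromℕ-+ a b)) (sym (+-assoc _ _ _))

  fromℕ-* : ∀ a b → fromℕ (a ℕ.* b) ≈ fromℕ a * fromℕ b
  fromℕ-* zero    b = sym (zeroˡ _)
  fromℕ-* (suc a) b = begin
    fromℕ (b ℕ.+ a ℕ.* b)            ≈⟨ trans (fromℕ-+ b (a ℕ.* b)) (+-congˡ (fromℕ-* a b)) ⟩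
    fromℕ b + fromℕ a * fromℕ b      ≈⟨ +-congʳ (*-identityˡ _) ⟨
    1# * fromℕ b + fromℕ a * fromℕ b ≈⟨ distribʳ _ _ _ ⟨
    (1# + fromℕ a) * fromℕ b         ∎

  -‿+-interchange : ∀ a b c d → (a - b) + (c - d) ≈ (a + c) - (b + d)
  -‿+-interchange a b c d = begin
    (a + - b) + (c + - d)    ≈⟨ +-solve 4 (λ a b c d → (a ⊕ b) ⊕ (c ⊕ d) ⊜ (a ⊕ c) ⊕ (b ⊕ d)) refl a (- b) c (- d) ⟩
    (a + c) + (- b + - d)    ≈⟨ +-congˡ (⁻¹-∙-comm b d) ⟩
    (a + c) - (b + d)        ∎

  -‿*-expand : ∀ a b c d → (a - b) * (c - d) ≈ (a * c + b * d) - (a * d + b * c)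
  -‿*-expand a b c d = begin
    (a + - b) * (c + - d)                        ≈⟨ distribʳ _ _ _ ⟩
    a * (c + - d) + - b * (c + - d)              ≈⟨ +-cong (distribˡ _ _ _) (distribˡ _ _ _) ⟩
    (a * c + a * - d) + (- b * c + - b * - d)
      ≈⟨ +-cong (+-congˡ (-‿distribʳ-* a d)) (+-cong (-‿distribˡ-* b c) (-‿distribˡ-* b (- d))) ⟨
    (a * c + - (a * d)) + (- (b * c) + - (b * - d))
      ≈⟨ +-congˡ (+-congˡ (trans (-‿cong (sym (-‿distribʳ-* b d))) (-‿involutive _))) ⟩
    (a * c + - (a * d)) + (- (b * c) + b * d)
      ≈⟨ +-solve 4 (λ x y z w → (x ⊕ y) ⊕ (z ⊕ w) ⊜ (x ⊕ w) ⊕ (y ⊕ z)) refl (a * c) (- (a * d)) (- (b * c)) (b * d) ⟩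
    (a * c + b * d) + (- (a * d) + - (b * c))    ≈⟨ +-congˡ (⁻¹-∙-comm _ _) ⟩
    (a * c + b * d) - (a * d + b * c)            ∎

  -‿cancelˡ : ∀ e a b → (e + a) - (e + b) ≈ a - b
  -‿cancelˡ e a b = begin
    (e + a) - (e + b)        ≈⟨ -‿+-interchange e e a b ⟨
    (e - e) + (a - b)        ≈⟨ +-congʳ (-‿inverseʳ e) ⟩
    0# + (a - b)             ≈⟨ +-identityˡ _ ⟩
    a - b                    ∎

  -‿cancelʳ : ∀ e a b → (a + e) - (b + e) ≈ a - b
  -‿cancelʳ e a b = trans (+-cong (+-comm a e) (-‿cong (+-comm b e))) (-‿cancelˡ e a b)

  -- Coefficients of the ring solver: a pair (a , b) stands for a - b, kept in the normal form where
  -- one component is 0 so that equal coefficients are syntactically equal.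
  private
    normalise : ℕ × ℕ → ℕ × ℕ
    normalise (a , b) = a ∸ b , b ∸ a

    Coeff : RawRing _ _
    Coeff = record
      { Carrier = ℕ × ℕ ; _≈_ = _≡_
      ; _+_ = λ { (a , b) (c , d) → normalise (a ℕ.+ c , b ℕ.+ d) }
      ; _*_ = λ { (a , b) (c , d) → normalise (a ℕ.* c ℕ.+ b ℕ.* d , a ℕ.* d ℕ.+ b ℕ.* c) }
      ; -_  = λ { (a , b) → b , a }
      ; 0#  = 0 , 0
      ; 1#  = 1 , 0
      }

    -- Like fromℕ, but with 1 ↦ 1# on the nose, so that solver constants evaluate to 0# and 1#.
    literal : ℕ → Carrier
    literal zero          = 0#
    literal 1             = 1#
    literal (suc (suc n)) = 1# + literal (suc n)

    literal≈fromℕ : ∀ n → literal n ≈ fromℕ n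
    literal≈fromℕ zero          = refl
    literal≈fromℕ 1             = sym (+-identityʳ 1#)
    literal≈fromℕ (suc (suc n)) = +-congˡ (literal≈fromℕ (suc n))

    ⟦_⟧ᶜ : ℕ × ℕ → Carrier
    ⟦ a , zero  ⟧ᶜ = literal a
    ⟦ a , suc b ⟧ᶜ = literal a - literal (suc b)

    ⟦⟧ᶜ≈- : ∀ a b → ⟦ a , b ⟧ᶜ ≈ fromℕ a - fromℕ b
    ⟦⟧ᶜ≈- a zero    = trans (literal≈fromℕ a) (trans (sym (+-identityʳ _)) (+-congˡ (sym -0#≈0#)))
    ⟦⟧ᶜ≈- a (suc b) = +-cong (literal≈fromℕ a) (-‿cong (literal≈fromℕ (suc b)))

    normalise-diff : ∀ a b → fromℕ (a ∸ b) - fromℕ (b ∸ a) ≈ fromℕ a - fromℕ b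
    normalise-diff zero    zero    = refl
    normalise-diff zero    (suc b) = refl
    normalise-diff (suc a) zero    = refl
    normalise-diff (suc a) (suc b) = trans (normalise-diff a b) (sym (-‿cancelˡ 1# _ _))

    ⟦normalise⟧ : ∀ a b → ⟦ normalise (a , b) ⟧ᶜ ≈ fromℕ a - fromℕ b
    ⟦normalise⟧ a b = trans (⟦⟧ᶜ≈- (a ∸ b) (b ∸ a)) (normalise-diff a b)

    ⟦_⟧ᶜ-homo : Coeff -Raw-AlmostCommutative⟶ fromCommutativeRing commutativeRing
    ⟦_⟧ᶜ-homo = record
      { ⟦_⟧    = ⟦_⟧ᶜ
      ; +-homo = λ { (a , b) (c , d) → begin
          ⟦ normalise (a ℕ.+ c , b ℕ.+ d) ⟧ᶜ          ≈⟨ ⟦normalise⟧ (a ℕ.+ c) (b ℕ.+ d) ⟩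
          fromℕ (a ℕ.+ c) - fromℕ (b ℕ.+ d)          ≈⟨ +-cong (fromℕ-+ a c) (-‿cong (fromℕ-+ b d)) ⟩
          (fromℕ a + fromℕ c) - (fromℕ b + fromℕ d)  ≈⟨ -‿+-interchange _ _ _ _ ⟨
          (fromℕ a - fromℕ b) + (fromℕ c - fromℕ d)  ≈⟨ +-cong (⟦⟧ᶜ≈- a b) (⟦⟧ᶜ≈- c d) ⟨
          ⟦ a , b ⟧ᶜ + ⟦ c , d ⟧ᶜ                     ∎ }
      ; *-homo = λ { (a , b) (c , d) → begin
          ⟦ normalise (a ℕ.* c ℕ.+ b ℕ.* d , a ℕ.* d ℕ.+ b ℕ.* c) ⟧ᶜ
            ≈⟨ ⟦normalise⟧ (a ℕ.* c ℕ.+ b ℕ.* d) (a ℕ.* d ℕ.+ b ℕ.* c) ⟩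
          fromℕ (a ℕ.* c ℕ.+ b ℕ.* d) - fromℕ (a ℕ.* d ℕ.+ b ℕ.* c)
            ≈⟨ +-cong (fromℕ-+-* a c b d) (-‿cong (fromℕ-+-* a d b c)) ⟩
          (fromℕ a * fromℕ c + fromℕ b * fromℕ d) - (fromℕ a * fromℕ d + fromℕ b * fromℕ c)
            ≈⟨ -‿*-expand _ _ _ _ ⟨
          (fromℕ a - fromℕ b) * (fromℕ c - fromℕ d)  ≈⟨ *-cong (⟦⟧ᶜ≈- a b) (⟦⟧ᶜ≈- c d) ⟨
          ⟦ a , b ⟧ᶜ * ⟦ c , d ⟧ᶜ                     ∎ }
      ; -‿homo = λ { (a , b) → begin
          ⟦ b , a ⟧ᶜ                 ≈⟨ ⟦⟧ᶜ≈- b a ⟩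
          fromℕ b - fromℕ a          ≈⟨ ⁻¹-anti-homo‿- (fromℕ a) (fromℕ b) ⟨
          - (fromℕ a - fromℕ b)      ≈⟨ -‿cong (⟦⟧ᶜ≈- a b) ⟨
          - ⟦ a , b ⟧ᶜ               ∎ }
      ; 0-homo = refl
      ; 1-homo = refl
      }
      where
      fromℕ-+-* : ∀ a b c d → fromℕ (a ℕ.* b ℕ.+ c ℕ.* d) ≈ fromℕ a * fromℕ b + fromℕ c * fromℕ d
      fromℕ-+-* a b c d = trans (fromℕ-+ (a ℕ.* b) (c ℕ.* d)) (+-cong (fromℕ-* a b) (fromℕ-* c d))

    coeff≟ : ∀ x y → Maybe (⟦ x ⟧ᶜ ≈ ⟦ y ⟧ᶜ)
    coeff≟ (a , b) (c , d) with a ℕ.+ d ℕ.≟ c ℕ.+ b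
    ... | no _   = nothing
    ... | yes eq = just (begin
      ⟦ a , b ⟧ᶜ                                 ≈⟨ ⟦⟧ᶜ≈- a b ⟩
      fromℕ a - fromℕ b                          ≈⟨ -‿cancelʳ (fromℕ d) _ _ ⟨
      (fromℕ a + fromℕ d) - (fromℕ b + fromℕ d)
        ≈⟨ +-congʳ (trans (sym (fromℕ-+ a d)) (trans (reflexive (≡.cong fromℕ eq)) (fromℕ-+ c b))) ⟩
      (fromℕ c + fromℕ b) - (fromℕ b + fromℕ d)  ≈⟨ +-congˡ (-‿cong (+-comm _ _)) ⟩
      (fromℕ c + fromℕ b) - (fromℕ d + fromℕ b)  ≈⟨ -‿cancelʳ (fromℕ b) _ _ ⟩
      fromℕ c - fromℕ d                          ≈⟨ ⟦⟧ᶜ≈- c d ⟨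
      ⟦ c , d ⟧ᶜ                                 ∎)

  private
    module Solver = RingSolver Coeff (fromCommutativeRing commutativeRing) ⟦_⟧ᶜ-homo coeff≟
  open Solver using (solve; _:=_; _:+_; _:*_; _:-_; :-_; con)

  :0 :1 : ∀ {n} → Solver.Polynomial n
  :0 = con (0 , 0)
  :1 = con (1 , 0)

  ^-+ : ∀ x a b → x ^ (a ℕ.+ b) ≈ x ^ a * x ^ b
  ^-+ x zero    b = sym (*-identityˡ _)
  ^-+ x (suc a) b = trans (*-congˡ (^-+ x a b)) (sym (*-assoc _ _ _))

  ^-* : ∀ x a b → x ^ (b ℕ.* a) ≈ (x ^ a) ^ b
  ^-* x a zero    = refl
  ^-* x a (suc b) = trans (^-+ x a (b ℕ.* a)) (*-congˡ (^-* x a b))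

  ^-cong : ∀ {x y} n → x ≈ y → x ^ n ≈ y ^ n
  ^-cong zero    _   = refl
  ^-cong (suc n) x≈y = *-cong x≈y (^-cong n x≈y)

  1^ : ∀ n → 1# ^ n ≈ 1#
  1^ zero    = refl
  1^ (suc n) = trans (*-identityˡ _) (1^ n)

  u*x≈y⇒x≈y÷u : ∀ {u x y} → ¬ (u ≈ 0#) → u * x ≈ y → x ≈ y ÷ u
  u*x≈y⇒x≈y÷u {u} {x} {y} u≉0 ux≈y = begin
    x                 ≈⟨ solve 3 (λ x u v → x := x :* :1) refl x u (u ⁻¹) ⟩
    x * 1#            ≈⟨ *-congˡ (inverse u u≉0) ⟨
    x * (u * u ⁻¹)    ≈⟨ solve 3 (λ x u v → x :* (u :* v) := (u :* x) :* v) refl x u (u ⁻¹) ⟩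
    (u * x) * u ⁻¹    ≈⟨ *-congʳ ux≈y ⟩
    y ÷ u             ∎

  root-pow : ∀ {x} M → x ^ M ≈ 1# → ∀ e → (x ^ e) ^ M ≈ 1#
  root-pow {x} M x^M≈1 e = begin
    (x ^ e) ^ M       ≈⟨ ^-* x e M ⟨
    x ^ (M ℕ.* e)     ≡⟨ ≡.cong (x ^_) (ℕₚ.*-comm M e) ⟩
    x ^ (e ℕ.* M)     ≈⟨ ^-* x M e ⟩
    (x ^ M) ^ e       ≈⟨ trans (^-cong e x^M≈1) (1^ e) ⟩
    1#                ∎

  primitiveRoot-∣ : ∀ {M x} .{{_ : ℕ.NonZero M}} → PrimitiveRoot M x → ∀ e → x ^ e ≈ 1# → M ∣ e
  primitiveRoot-∣ {M} {x} (x^M≈1 , x^d≉1) e x^e≈1 with e % M ℕ.≟ 0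
  ... | yes e%M≡0 = m%n≡0⇒n∣m e M e%M≡0
  ... | no  e%M≢0 = ⊥-elim (x^d≉1 (e % M) (ℕₚ.n≢0⇒n>0 e%M≢0) (m%n<n e M) (begin
    x ^ (e % M)                        ≈⟨ solve 1 (λ a → a := a :* :1) refl _ ⟩
    x ^ (e % M) * 1#                   ≈⟨ *-congˡ (trans (^-cong (e / M) x^M≈1) (1^ (e / M))) ⟨
    x ^ (e % M) * (x ^ M) ^ (e / M)    ≈⟨ *-congˡ (^-* x M (e / M)) ⟨
    x ^ (e % M) * x ^ (e / M ℕ.* M)    ≈⟨ ^-+ x (e % M) _ ⟨
    x ^ (e % M ℕ.+ e / M ℕ.* M)        ≡⟨ ≡.cong (x ^_) (m≡m%n+[m/n]*n e M) ⟨
    x ^ e                              ≈⟨ x^e≈1 ⟩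
    1#                                 ∎))

  1-x≈0⇒x≈1 : ∀ {x} → 1# - x ≈ 0# → x ≈ 1#
  1-x≈0⇒x≈1 {x} 1-x≈0 = begin
    x              ≈⟨ solve 1 (λ x → x := :1 :- (:1 :- x)) refl x ⟩
    1# - (1# - x)  ≈⟨ +-congˡ (-‿cong 1-x≈0) ⟩
    1# - 0#        ≈⟨ solve 0 (:1 :- :0 := :1) refl ⟩
    1#             ∎

  Σ<-cong : ∀ n {f g : ℕ → Carrier} → (∀ j → f j ≈ g j) → Σ< n f ≈ Σ< n g
  Σ<-cong zero    _   = refl
  Σ<-cong (suc n) f≈g = +-cong (Σ<-cong n f≈g) (f≈g n)

  Π<-cong : ∀ n {f g : ℕ → Carrier} → (∀ j → f j ≈ g j) → Π< n f ≈ Π< n g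
  Π<-cong zero    _   = refl
  Π<-cong (suc n) f≈g = *-cong (Π<-cong n f≈g) (f≈g n)

  Σ<-zero : ∀ n → Σ< n (λ _ → 0#) ≈ 0#
  Σ<-zero zero    = refl
  Σ<-zero (suc n) = trans (+-identityʳ _) (Σ<-zero n)

  Σ<-+ : ∀ n f g → Σ< n (λ j → f j + g j) ≈ Σ< n f + Σ< n g
  Σ<-+ zero    f g = sym (+-identityʳ 0#)
  Σ<-+ (suc n) f g = trans (+-congʳ (Σ<-+ n f g))
    (solve 4 (λ a b c d → (a :+ b) :+ (c :+ d) := (a :+ c) :+ (b :+ d)) refl _ _ _ _)

  Σ<-*ˡ : ∀ n a f → Σ< n (λ j → a * f j) ≈ a * Σ< n f
  Σ<-*ˡ zero    a f = sym (zeroʳ a)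
  Σ<-*ˡ (suc n) a f = trans (+-congʳ (Σ<-*ˡ n a f)) (sym (distribˡ _ _ _))

  Σ<-suc : ∀ n f → Σ< (suc n) f ≈ f 0 + Σ< n (λ j → f (suc j))
  Σ<-suc zero    f = trans (+-identityˡ _) (sym (+-identityʳ _))
  Σ<-suc (suc n) f = trans (+-congʳ (Σ<-suc n f)) (+-assoc _ _ _)

  powerSum : Carrier → ℕ → Carrier
  powerSum ζ m = Σ< m (ζ ^_)

  geometric : ∀ ζ m → (1# - ζ) * powerSum ζ m ≈ 1# - ζ ^ m
  geometric ζ zero    = solve 1 (λ z → (:1 :- z) :* :0 := :1 :- :1) refl ζ
  geometric ζ (suc m) = begin
    (1# - ζ) * (powerSum ζ m + ζ ^ m)          ≈⟨ distribˡ _ _ _ ⟩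
    (1# - ζ) * powerSum ζ m + (1# - ζ) * ζ ^ m ≈⟨ +-congʳ (geometric ζ m) ⟩
    (1# - ζ ^ m) + (1# - ζ) * ζ ^ m            ≈⟨ solve 2 (λ z p → (:1 :- p) :+ (:1 :- z) :* p := :1 :- z :* p) refl ζ (ζ ^ m) ⟩
    1# - ζ ^ suc m                             ∎

  powerSum-root : ∀ {ζ} M → ζ ^ M ≈ 1# → ¬ (1# - ζ ≈ 0#) → powerSum ζ M ≈ 0#
  powerSum-root {ζ} M ζ^M≈1 ζ≉1 = begin
    powerSum ζ M        ≈⟨ u*x≈y⇒x≈y÷u ζ≉1 (trans (geometric ζ M) (trans (+-congˡ (-‿cong ζ^M≈1)) (-‿inverseʳ 1#))) ⟩
    0# ÷ (1# - ζ)       ≈⟨ zeroˡ _ ⟩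
    0#                  ∎

  -- A series f stands for Σ_k f k z^k: shift f is z f and Δ f is (1 - z) f. A list a₀ ∷ a₁ ∷ … stands
  -- for the polynomial a₀ + a₁ z + ⋯, and P ⋆ f is the product P(z) f(z).
  Series : Set c
  Series = ℕ → Carrier

  infix 4 _≋_
  _≋_ : Series → Series → Set ℓ
  f ≋ g = ∀ k → f k ≈ g k

  ≋-sym : ∀ {f g} → f ≋ g → g ≋ f
  ≋-sym f≋g k = sym (f≋g k)

  ≋-trans : ∀ {f g h} → f ≋ g → g ≋ h → f ≋ h
  ≋-trans f≋g g≋h k = trans (f≋g k) (g≋h k)

  shift : Series → Series
  shift f zero    = 0#
  shift f (suc k) = f k

  shiftBy : ℕ → Series → Series
  shiftBy zero    f = f
  shiftBy (suc j) f = shift (shiftBy j f)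

  shift-cong : ∀ {f g} → f ≋ g → shift f ≋ shift g
  shift-cong f≋g zero    = refl
  shift-cong f≋g (suc k) = f≋g k

  shiftBy-cong : ∀ j {f g} → f ≋ g → shiftBy j f ≋ shiftBy j g
  shiftBy-cong zero    f≋g = f≋g
  shiftBy-cong (suc j) f≋g = shift-cong (shiftBy-cong j f≋g)

  shiftBy-+ : ∀ i j f → shiftBy (i ℕ.+ j) f ≋ shiftBy i (shiftBy j f)
  shiftBy-+ zero    j f k = refl
  shiftBy-+ (suc i) j f   = shift-cong (shiftBy-+ i j f)

  shiftBy-map : ∀ (g : Carrier → Carrier) → g 0# ≈ 0# →
                ∀ j f → shiftBy j (λ k → g (f k)) ≋ λ k → g (shiftBy j f k)
  shiftBy-map g g0 zero    f k       = refl
  shiftBy-map g g0 (suc j) f zero    = sym g0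
  shiftBy-map g g0 (suc j) f (suc k) = shiftBy-map g g0 j f k

  shiftBy-zipWith : ∀ (g : Carrier → Carrier → Carrier) → g 0# 0# ≈ 0# →
                    ∀ j f h → shiftBy j (λ k → g (f k) (h k)) ≋ λ k → g (shiftBy j f k) (shiftBy j h k)
  shiftBy-zipWith g g0 zero    f h k       = refl
  shiftBy-zipWith g g0 (suc j) f h zero    = sym g0
  shiftBy-zipWith g g0 (suc j) f h (suc k) = shiftBy-zipWith g g0 j f h k

  infixr 7 _⋆_
  _⋆_ : List Carrier → Series → Series
  ([]      ⋆ f) k = 0#
  ((a ∷ P) ⋆ f) k = a * f k + shift (P ⋆ f) k

  ⋆-cong : ∀ P {f g} → f ≋ g → P ⋆ f ≋ P ⋆ g
  ⋆-cong []      f≋g k = refl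
  ⋆-cong (a ∷ P) f≋g k = +-cong (*-congˡ (f≋g k)) (shift-cong (⋆-cong P f≋g) k)

  ⋆-++ : ∀ P Q f → (P ++ Q) ⋆ f ≋ λ k → (P ⋆ f) k + shiftBy (length P) (Q ⋆ f) k
  ⋆-++ []      Q f k = sym (+-identityˡ _)
  ⋆-++ (a ∷ P) Q f zero    = sym (+-identityʳ _)
  ⋆-++ (a ∷ P) Q f (suc k) = trans (+-congˡ (⋆-++ P Q f k)) (sym (+-assoc _ _ _))

  ⋆-map-* : ∀ x P f → map (x *_) P ⋆ f ≋ λ k → x * (P ⋆ f) k
  ⋆-map-* x []      f k = sym (zeroʳ x)
  ⋆-map-* x (a ∷ P) f k = begin
    x * a * f k + shift (map (x *_) P ⋆ f) k   ≈⟨ +-congˡ (shift-cong (⋆-map-* x P f) k) ⟩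
    x * a * f k + shift (λ k → x * (P ⋆ f) k) k ≈⟨ +-congˡ (shiftBy-map (x *_) (zeroʳ x) 1 (P ⋆ f) k) ⟩
    x * a * f k + x * shift (P ⋆ f) k          ≈⟨ solve 4 (λ x a b s → x :* a :* b :+ x :* s := x :* (a :* b :+ s)) refl x a (f k) _ ⟩
    x * (a * f k + shift (P ⋆ f) k)            ∎

  Δ : Series → Series
  Δ f k = f k - shift f k

  Δ-cong : ∀ {f g} → f ≋ g → Δ f ≋ Δ g
  Δ-cong f≋g k = +-cong (f≋g k) (-‿cong (shift-cong f≋g k))

  ⋆-Δ : ∀ P f → P ⋆ Δ f ≋ Δ (P ⋆ f)
  ⋆-Δ []      f zero    = sym (-‿inverseʳ 0#)
  ⋆-Δ []      f (suc k) = sym (-‿inverseʳ 0#)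
  ⋆-Δ (a ∷ P) f zero    = solve 2 (λ a x → a :* (x :- :0) :+ :0 := (a :* x :+ :0) :- :0) refl a (f 0)
  ⋆-Δ (a ∷ P) f (suc k) = begin
    a * (f (suc k) - f k) + (P ⋆ Δ f) k                  ≈⟨ +-congˡ (⋆-Δ P f k) ⟩
    a * (f (suc k) - f k) + ((P ⋆ f) k - shift (P ⋆ f) k)
      ≈⟨ solve 5 (λ a x y u v → a :* (x :- y) :+ (u :- v) := (a :* x :+ u) :- (a :* y :+ v)) refl
                 a (f (suc k)) (f k) ((P ⋆ f) k) (shift (P ⋆ f) k) ⟩
    Δ ((a ∷ P) ⋆ f) (suc k)                              ∎

  replicate-⋆-Δ : ∀ L x f → replicate L x ⋆ Δ f ≋ λ k → x * (f k - shiftBy L f k)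
  replicate-⋆-Δ zero    x f k       = solve 2 (λ x y → :0 := x :* (y :- y)) refl x (f k)
  replicate-⋆-Δ (suc L) x f zero    = +-identityʳ _
  replicate-⋆-Δ (suc L) x f (suc k) = begin
    x * (f (suc k) - f k) + (replicate L x ⋆ Δ f) k         ≈⟨ +-congˡ (replicate-⋆-Δ L x f k) ⟩
    x * (f (suc k) - f k) + x * (f k - shiftBy L f k)
      ≈⟨ solve 4 (λ x a b c → x :* (a :- b) :+ x :* (b :- c) := x :* (a :- c)) refl x (f (suc k)) (f k) _ ⟩
    x * (f (suc k) - shiftBy L f k)                          ∎

  Δ^ : ℕ → Series → Series
  Δ^ zero    f = f
  Δ^ (suc n) f = Δ (Δ^ n f)

  Δ^-cong : ∀ n {f g} → f ≋ g → Δ^ n f ≋ Δ^ n g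
  Δ^-cong zero    f≋g = f≋g
  Δ^-cong (suc n) f≋g = Δ-cong (Δ^-cong n f≋g)

  Δ^-suc : ∀ n f → Δ^ (suc n) f ≋ Δ^ n (Δ f)
  Δ^-suc zero    f k = refl
  Δ^-suc (suc n) f   = Δ-cong (Δ^-suc n f)

  δ : Series
  δ zero    = 1#
  δ (suc _) = 0#

  -- coefficients of (1 - z)^-(p+1)
  binomialSeries : ℕ → Series
  binomialSeries p j = fromℕ ((j ℕ.+ p) C p)

  Δ-binomialSeries-zero : Δ (binomialSeries 0) ≋ δ
  Δ-binomialSeries-zero zero    = trans (+-congʳ (+-identityʳ 1#)) (trans (+-congˡ -0#≈0#) (+-identityʳ 1#))
  Δ-binomialSeries-zero (suc k) = -‿inverseʳ (fromℕ 1)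

  Δ-binomialSeries-suc : ∀ p → Δ (binomialSeries (suc p)) ≋ binomialSeries p
  Δ-binomialSeries-suc p zero = begin
    fromℕ (suc p C suc p) - 0#   ≈⟨ +-cong (reflexive (≡.cong fromℕ (nCn≡1 (suc p)))) -0#≈0# ⟩
    fromℕ 1 + 0#                 ≈⟨ +-identityʳ _ ⟩
    fromℕ 1                      ≈⟨ reflexive (≡.cong fromℕ (nCn≡1 p)) ⟨
    fromℕ (p C p)                ∎
  Δ-binomialSeries-suc p (suc j) = begin
    fromℕ (suc n C suc p) - fromℕ (n C suc p)
      ≈⟨ +-congʳ (reflexive (≡.cong fromℕ (nCk+nC[k+1]≡[n+1]C[k+1] n p))) ⟨
    fromℕ (n C p ℕ.+ n C suc p) - fromℕ (n C suc p)    ≈⟨ +-congʳ (fromℕ-+ (n C p) _) ⟩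
    (fromℕ (n C p) + fromℕ (n C suc p)) - fromℕ (n C suc p)
      ≈⟨ solve 2 (λ a b → (a :+ b) :- b := a) refl _ _ ⟩
    fromℕ (n C p)                                      ≈⟨ reflexive (≡.cong (λ m → fromℕ (m C p)) (ℕₚ.+-suc j p)) ⟩
    fromℕ ((suc j ℕ.+ p) C p)                          ∎
    where n = j ℕ.+ suc p

  Δ^-binomialSeries : ∀ p → Δ^ (suc p) (binomialSeries p) ≋ δ
  Δ^-binomialSeries zero    = Δ-binomialSeries-zero
  Δ^-binomialSeries (suc p) = ≋-trans (Δ^-suc (suc p) _)
    (≋-trans (Δ^-cong (suc p) (Δ-binomialSeries-suc p)) (Δ^-binomialSeries p))

  coeff : List Carrier → ℕ → Carrier
  coeff []      m       = 0#
  coeff (a ∷ P) zero    = a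
  coeff (a ∷ P) (suc m) = coeff P m

  ⋆-cauchy : ∀ P f k → (P ⋆ f) k ≈ Σ< (suc k) (λ m → coeff P m * f (k ∸ m))
  ⋆-cauchy []      f k       = sym (trans (Σ<-cong (suc k) (λ _ → zeroˡ _)) (Σ<-zero (suc k)))
  ⋆-cauchy (a ∷ P) f zero    = trans (+-identityʳ _) (sym (+-identityˡ _))
  ⋆-cauchy (a ∷ P) f (suc k) =
    trans (+-congˡ (⋆-cauchy P f k)) (sym (Σ<-suc (suc k) (λ m → coeff (a ∷ P) m * f (suc k ∸ m))))

  coeff-beyond : ∀ P m → length P ≤ m → coeff P m ≈ 0#
  coeff-beyond []      m       _         = refl
  coeff-beyond (a ∷ P) (suc m) (s≤s P≤m) = coeff-beyond P m P≤m

  coeff-++ˡ : ∀ P Q m → m < length P → coeff (P ++ Q) m ≈ coeff P m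
  coeff-++ˡ (a ∷ P) Q zero    _         = refl
  coeff-++ˡ (a ∷ P) Q (suc m) (s≤s m<P) = coeff-++ˡ P Q m m<P

  coeff-++ʳ : ∀ P Q m → coeff (P ++ Q) (length P ℕ.+ m) ≈ coeff Q m
  coeff-++ʳ []      Q m = refl
  coeff-++ʳ (a ∷ P) Q m = coeff-++ʳ P Q m

  coeff-map-* : ∀ x P m → coeff (map (x *_) P) m ≈ x * coeff P m
  coeff-map-* x []      m       = sym (zeroʳ x)
  coeff-map-* x (a ∷ P) zero    = refl
  coeff-map-* x (a ∷ P) (suc m) = coeff-map-* x P m

  VanishesFrom : ℕ → Series → Set ℓ
  VanishesFrom K f = ∀ k → K ≤ k → f k ≈ 0#

  moment : ℕ → Series → Carrier
  moment K f = Σ< K (λ k → fromℕ k * f k)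

  valueAt1 slopeAt1 : List Carrier → Carrier
  valueAt1 []      = 0#
  valueAt1 (a ∷ P) = a + valueAt1 P
  slopeAt1 []      = 0#
  slopeAt1 (a ∷ P) = valueAt1 P + slopeAt1 P

  Σ<-vanishing : ∀ {K f} → VanishesFrom K f → ∀ j → Σ< (j ℕ.+ K) f ≈ Σ< K f
  Σ<-vanishing f↓ zero    = refl
  Σ<-vanishing {K} f↓ (suc j) =
    trans (+-cong (Σ<-vanishing f↓ j) (f↓ _ (ℕₚ.m≤n+m K j))) (+-identityʳ _)

  moment-vanishing : ∀ {K f} → VanishesFrom K f → ∀ j → moment (j ℕ.+ K) f ≈ moment K f
  moment-vanishing f↓ = Σ<-vanishing (λ k K≤k → trans (*-congˡ (f↓ k K≤k)) (zeroʳ _))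

  Σ<-shift : ∀ n f → Σ< (suc n) (shift f) ≈ Σ< n f
  Σ<-shift n f = trans (Σ<-suc n (shift f)) (+-identityˡ _)

  moment-shift : ∀ n f → moment (suc n) (shift f) ≈ Σ< n f + moment n f
  moment-shift n f = begin
    moment (suc n) (shift f)                     ≈⟨ Σ<-suc n (λ k → fromℕ k * shift f k) ⟩
    0# * 0# + Σ< n (λ j → (1# + fromℕ j) * f j) ≈⟨ trans (+-congʳ (zeroˡ 0#)) (+-identityˡ _) ⟩
    Σ< n (λ j → (1# + fromℕ j) * f j)
      ≈⟨ Σ<-cong n (λ j → solve 2 (λ a x → (:1 :+ a) :* x := x :+ a :* x) refl (fromℕ j) (f j)) ⟩
    Σ< n (λ j → f j + fromℕ j * f j)             ≈⟨ Σ<-+ n f _ ⟩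
    Σ< n f + moment n f                          ∎

  ⋆-vanishesFrom : ∀ P {K f} → VanishesFrom K f → VanishesFrom (length P ℕ.+ K) (P ⋆ f)
  ⋆-vanishesFrom []      f↓ k K≤k = refl
  ⋆-vanishesFrom (a ∷ P) {K} {f} f↓ (suc k) (s≤s P+K≤k) = begin
    a * f (suc k) + (P ⋆ f) k
      ≈⟨ +-cong (*-congˡ (f↓ _ (ℕₚ.≤-trans (ℕₚ.m≤n+m K (length P)) (ℕₚ.m≤n⇒m≤1+n P+K≤k))))
                (⋆-vanishesFrom P f↓ k P+K≤k) ⟩
    a * 0# + 0#                                  ≈⟨ solve 1 (λ a → a :* :0 :+ :0 := :0) refl a ⟩
    0#                                           ∎

  Σ<-⋆ : ∀ P {K f} → VanishesFrom K f → Σ< (length P ℕ.+ K) (P ⋆ f) ≈ valueAt1 P * Σ< K f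
  Σ<-⋆ []      {K} f↓ = trans (Σ<-zero K) (sym (zeroˡ _))
  Σ<-⋆ (a ∷ P) {K} {f} f↓ = begin
    Σ< (suc n) (λ k → a * f k + shift (P ⋆ f) k)           ≈⟨ Σ<-+ (suc n) _ _ ⟩
    Σ< (suc n) (λ k → a * f k) + Σ< (suc n) (shift (P ⋆ f)) ≈⟨ +-cong (Σ<-*ˡ (suc n) a f) (Σ<-shift n _) ⟩
    a * Σ< (suc n) f + Σ< n (P ⋆ f)
      ≈⟨ +-cong (*-congˡ (Σ<-vanishing f↓ (suc (length P)))) (Σ<-⋆ P f↓) ⟩
    a * Σ< K f + valueAt1 P * Σ< K f                       ≈⟨ distribʳ _ _ _ ⟨
    (a + valueAt1 P) * Σ< K f                              ∎
    where n = length P ℕ.+ K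

  moment-⋆ : ∀ P {K f} → VanishesFrom K f →
             moment (length P ℕ.+ K) (P ⋆ f) ≈ valueAt1 P * moment K f + slopeAt1 P * Σ< K f
  moment-⋆ []      {K} f↓ = trans (trans (Σ<-cong K (λ _ → zeroʳ _)) (Σ<-zero K))
    (solve 2 (λ a b → :0 := :0 :* a :+ :0 :* b) refl _ _)
  moment-⋆ (a ∷ P) {K} {f} f↓ = begin
    moment (suc n) ((a ∷ P) ⋆ f)
      ≈⟨ Σ<-cong (suc n) (λ k → solve 4 (λ i a x s → i :* (a :* x :+ s) := a :* (i :* x) :+ i :* s) refl
                                         (fromℕ k) a (f k) (shift (P ⋆ f) k)) ⟩
    Σ< (suc n) (λ k → a * (fromℕ k * f k) + fromℕ k * shift (P ⋆ f) k)  ≈⟨ Σ<-+ (suc n) _ _ ⟩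
    Σ< (suc n) (λ k → a * (fromℕ k * f k)) + moment (suc n) (shift (P ⋆ f))
      ≈⟨ +-cong (Σ<-*ˡ (suc n) a _) (moment-shift n (P ⋆ f)) ⟩
    a * moment (suc n) f + (Σ< n (P ⋆ f) + moment n (P ⋆ f))
      ≈⟨ +-cong (*-congˡ (moment-vanishing f↓ (suc (length P)))) (+-cong (Σ<-⋆ P f↓) (moment-⋆ P f↓)) ⟩
    a * m + (v * s + (v * m + d * s))
      ≈⟨ solve 5 (λ a v d m s → a :* m :+ (v :* s :+ (v :* m :+ d :* s)) := (a :+ v) :* m :+ (v :+ d) :* s)
                 refl a v d m s ⟩
    (a + v) * m + (v + d) * s                              ∎
    where n = length P ℕ.+ K
          v = valueAt1 P
          d = slopeAt1 P
          m = moment K f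
          s = Σ< K f

  geomMul : Carrier → ℕ → ℕ → Series → Series
  geomMul ζ n L f k = Σ< n (λ j → ζ ^ j * shiftBy (j ℕ.* L) f k)

  geomMul-cong : ∀ ζ n L {f g} → f ≋ g → geomMul ζ n L f ≋ geomMul ζ n L g
  geomMul-cong ζ n L f≋g k = Σ<-cong n (λ j → *-congˡ (shiftBy-cong (j ℕ.* L) f≋g k))

  blocks : Carrier → ℕ → List Carrier → List Carrier
  blocks ζ zero    P = []
  blocks ζ (suc n) P = blocks ζ n P ++ map (ζ ^ n *_) P

  length-blocks : ∀ ζ n P → length (blocks ζ n P) ≡ n ℕ.* length P
  length-blocks ζ zero    P = ≡.refl
  length-blocks ζ (suc n) P = ≡.trans (length-++ (blocks ζ n P))
    (≡.trans (≡.cong₂ ℕ._+_ (length-blocks ζ n P) (length-map _ P)) (ℕₚ.+-comm (n ℕ.* length P) _))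

  blocks-⋆ : ∀ ζ n P f → blocks ζ n P ⋆ f ≋ geomMul ζ n (length P) (P ⋆ f)
  blocks-⋆ ζ zero    P f k = refl
  blocks-⋆ ζ (suc n) P f k = begin
    ((blocks ζ n P ++ map (ζ ^ n *_) P) ⋆ f) k                              ≈⟨ ⋆-++ (blocks ζ n P) _ f k ⟩
    (blocks ζ n P ⋆ f) k + shiftBy (length (blocks ζ n P)) (map (ζ ^ n *_) P ⋆ f) k
      ≈⟨ +-cong (blocks-⋆ ζ n P f k) (reflexive (≡.cong (λ e → shiftBy e (map (ζ ^ n *_) P ⋆ f) k) (length-blocks ζ n P))) ⟩
    geomMul ζ n L (P ⋆ f) k + shiftBy (n ℕ.* L) (map (ζ ^ n *_) P ⋆ f) k
      ≈⟨ +-congˡ (trans (shiftBy-cong (n ℕ.* L) (⋆-map-* (ζ ^ n) P f) k) (shiftBy-map (ζ ^ n *_) (zeroʳ _) (n ℕ.* L) (P ⋆ f) k)) ⟩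
    geomMul ζ (suc n) L (P ⋆ f) k                                            ∎
    where L = length P

  coeff-blocks : ∀ ζ n P {j r} → j < n → r < length P →
                 coeff (blocks ζ n P) (j ℕ.* length P ℕ.+ r) ≈ ζ ^ j * coeff P r
  coeff-blocks ζ (suc n) P {j} {r} j<1+n r<L with ℕₚ.m<1+n⇒m<n∨m≡n j<1+n
  ... | inj₁ j<n = trans (coeff-++ˡ (blocks ζ n P) _ _ (≡.subst (_ <_) (≡.sym (length-blocks ζ n P)) index<))
                         (coeff-blocks ζ n P j<n r<L)
    where
    index< : j ℕ.* length P ℕ.+ r < n ℕ.* length P
    index< = ℕₚ.<-≤-trans (ℕₚ.+-monoʳ-< (j ℕ.* length P) r<L)
               (≡.subst (ℕ._≤ n ℕ.* length P) (ℕₚ.+-comm (length P) _) (ℕₚ.*-monoˡ-≤ (length P) j<n))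
  ... | inj₂ ≡.refl = begin
    coeff (blocks ζ j P ++ map (ζ ^ j *_) P) (j ℕ.* length P ℕ.+ r)
      ≈⟨ reflexive (≡.cong (λ e → coeff (blocks ζ j P ++ map (ζ ^ j *_) P) (e ℕ.+ r)) (≡.sym (length-blocks ζ j P))) ⟩
    coeff (blocks ζ j P ++ map (ζ ^ j *_) P) (length (blocks ζ j P) ℕ.+ r)  ≈⟨ coeff-++ʳ (blocks ζ j P) _ r ⟩
    coeff (map (ζ ^ j *_) P) r                                            ≈⟨ coeff-map-* (ζ ^ j) P r ⟩
    ζ ^ j * coeff P r                                                     ∎

  hPoly : Carrier → ℕ → ℕ → List Carrier
  hPoly ζ zero    L = []
  hPoly ζ (suc n) L = hPoly ζ n L ++ replicate L (powerSum ζ (suc n))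

  length-hPoly : ∀ ζ n L → length (hPoly ζ n L) ≡ n ℕ.* L
  length-hPoly ζ zero    L = ≡.refl
  length-hPoly ζ (suc n) L = ≡.trans (length-++ (hPoly ζ n L))
    (≡.trans (≡.cong₂ ℕ._+_ (length-hPoly ζ n L) (length-replicate L)) (ℕₚ.+-comm (n ℕ.* L) L))

  -- Telescoping: 1 - z turns the j-th block into powerSum ζ (suc j) (z^(jL) - z^((j+1)L)),
  -- and consecutive power sums differ by ζ^j.
  hPoly-⋆-Δ : ∀ ζ n L f → hPoly ζ n L ⋆ Δ f ≋ λ k → geomMul ζ n L f k - powerSum ζ n * shiftBy (n ℕ.* L) f k
  hPoly-⋆-Δ ζ zero    L f k = solve 1 (λ s → :0 := :0 :- :0 :* s) refl (f k)
  hPoly-⋆-Δ ζ (suc n) L f k = begin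
    ((hPoly ζ n L ++ replicate L w) ⋆ Δ f) k   ≈⟨ ⋆-++ (hPoly ζ n L) _ (Δ f) k ⟩
    (hPoly ζ n L ⋆ Δ f) k + shiftBy (length (hPoly ζ n L)) (replicate L w ⋆ Δ f) k
      ≈⟨ +-cong (hPoly-⋆-Δ ζ n L f k) (reflexive (≡.cong (λ e → shiftBy e (replicate L w ⋆ Δ f) k) (length-hPoly ζ n L))) ⟩
    (geomMul ζ n L f k - powerSum ζ n * S) + shiftBy (n ℕ.* L) (replicate L w ⋆ Δ f) k
      ≈⟨ +-congˡ (shiftBy-cong (n ℕ.* L) (replicate-⋆-Δ L w f) k) ⟩
    (geomMul ζ n L f k - powerSum ζ n * S) + shiftBy (n ℕ.* L) (λ k → w * (f k - shiftBy L f k)) k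
      ≈⟨ +-congˡ (shiftBy-zipWith (λ u v → w * (u - v)) (solve 1 (λ w → w :* (:0 :- :0) := :0) refl w) (n ℕ.* L) f _ k) ⟩
    (geomMul ζ n L f k - powerSum ζ n * S) + w * (S - shiftBy (n ℕ.* L) (shiftBy L f) k)
      ≈⟨ +-congˡ (*-congˡ (+-congˡ (-‿cong (sym shifts)))) ⟩
    (geomMul ζ n L f k - powerSum ζ n * S) + (powerSum ζ n + ζ ^ n) * (S - T)
      ≈⟨ solve 5 (λ g p z s t → (g :- p :* s) :+ (p :+ z) :* (s :- t) := (g :+ z :* s) :- (p :+ z) :* t)
                 refl (geomMul ζ n L f k) (powerSum ζ n) (ζ ^ n) S T ⟩
    geomMul ζ (suc n) L f k - powerSum ζ (suc n) * T  ∎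
    where
    w = powerSum ζ (suc n)
    S = shiftBy (n ℕ.* L) f k
    T = shiftBy (suc n ℕ.* L) f k
    shifts : T ≈ shiftBy (n ℕ.* L) (shiftBy L f) k
    shifts = trans (reflexive (≡.cong (λ e → shiftBy e f k) (ℕₚ.+-comm L (n ℕ.* L)))) (shiftBy-+ (n ℕ.* L) L f k)

  geomMul-root : ∀ {ζ} M L → ζ ^ M ≈ 1# → ¬ (1# - ζ ≈ 0#) → ∀ f → geomMul ζ M L f ≋ hPoly ζ M L ⋆ Δ f
  geomMul-root {ζ} M L ζ^M≈1 ζ≉1 f k = sym (begin
    (hPoly ζ M L ⋆ Δ f) k                                        ≈⟨ hPoly-⋆-Δ ζ M L f k ⟩
    geomMul ζ M L f k - powerSum ζ M * shiftBy (M ℕ.* L) f k     ≈⟨ +-congˡ (-‿cong (*-congʳ (powerSum-root M ζ^M≈1 ζ≉1))) ⟩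
    geomMul ζ M L f k - 0# * shiftBy (M ℕ.* L) f k               ≈⟨ solve 2 (λ g s → g :- :0 :* s := g) refl _ _ ⟩
    geomMul ζ M L f k                                            ∎)

  module PolyProduct (h : ℕ → List Carrier) where

    hProduct : ℕ → Series → Series
    hProduct zero    f = f
    hProduct (suc n) f = h n ⋆ hProduct n f

    hProduct-cong : ∀ n {f g} → f ≋ g → hProduct n f ≋ hProduct n g
    hProduct-cong zero    f≋g = f≋g
    hProduct-cong (suc n) f≋g = ⋆-cong (h n) (hProduct-cong n f≋g)

    hProduct-Δ : ∀ n f → hProduct n (Δ f) ≋ Δ (hProduct n f)
    hProduct-Δ zero    f k = refl
    hProduct-Δ (suc n) f   = ≋-trans (⋆-cong (h n) (hProduct-Δ n f)) (⋆-Δ (h n) (hProduct n f))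

    supportBound : ℕ → ℕ
    supportBound zero    = 1
    supportBound (suc n) = length (h n) ℕ.+ supportBound n

    hProduct-δ-vanishes : ∀ n → VanishesFrom (supportBound n) (hProduct n δ)
    hProduct-δ-vanishes zero    (suc k) _ = refl
    hProduct-δ-vanishes (suc n) = ⋆-vanishesFrom (h n) (hProduct-δ-vanishes n)

    Σ<-hProduct-δ : ∀ n → Σ< (supportBound n) (hProduct n δ) ≈ Π< n (λ l → valueAt1 (h l))
    Σ<-hProduct-δ zero    = +-identityˡ 1#
    Σ<-hProduct-δ (suc n) = trans (Σ<-⋆ (h n) (hProduct-δ-vanishes n)) (trans (*-congˡ (Σ<-hProduct-δ n)) (*-comm _ _))

    -- The logarithmic derivative of a product is the sum of the logarithmic derivatives.
    moment-hProduct-δ : (E : ℕ → Carrier) → (∀ l → slopeAt1 (h l) ≈ valueAt1 (h l) * E l) →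
                        ∀ n → moment (supportBound n) (hProduct n δ) ≈ Σ< (supportBound n) (hProduct n δ) * Σ< n E
    moment-hProduct-δ E slope zero = solve 1 (λ x → :0 :+ :0 :* x := (:0 :+ x) :* :0) refl 1#
    moment-hProduct-δ E slope (suc n) = begin
      moment (supportBound (suc n)) (h n ⋆ f)          ≈⟨ moment-⋆ (h n) (hProduct-δ-vanishes n) ⟩
      v * moment K f + slopeAt1 (h n) * Σ< K f          ≈⟨ +-cong (*-congˡ (moment-hProduct-δ E slope n)) (*-congʳ (slope n)) ⟩
      v * (Σ< K f * Σ< n E) + v * E n * Σ< K f
        ≈⟨ solve 4 (λ v s e x → v :* (s :* e) :+ v :* x :* s := v :* s :* (e :+ x)) refl v (Σ< K f) (Σ< n E) (E n) ⟩
      v * Σ< K f * Σ< (suc n) E                        ≈⟨ *-congʳ (Σ<-⋆ (h n) (hProduct-δ-vanishes n)) ⟨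
      Σ< (supportBound (suc n)) (h n ⋆ f) * Σ< (suc n) E ∎
      where f = hProduct n δ
            K = supportBound n
            v = valueAt1 (h n)

  module Factorisation (M : ℕ) (ζ : ℕ → Carrier) where

    -- G_n(z) = ∏_{l<n} Σ_{j<M} (ζ_l z^(M^l))^j; the paper's G_p is G_(p+1).
    gPoly : ℕ → List Carrier
    gPoly zero    = 1# ∷ []
    gPoly (suc n) = blocks (ζ n) M (gPoly n)

    length-gPoly : ∀ n → length (gPoly n) ≡ M ℕ.^ n
    length-gPoly zero    = ≡.refl
    length-gPoly (suc n) = ≡.trans (length-blocks (ζ n) M (gPoly n)) (≡.cong (M ℕ.*_) (length-gPoly n))

    h : ℕ → List Carrier
    h l = hPoly (ζ l) M (M ℕ.^ l)

    open PolyProduct h public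

    gPoly-⋆ : (∀ l → ζ l ^ M ≈ 1#) → (∀ l → ¬ (1# - ζ l ≈ 0#)) → ∀ n f → gPoly n ⋆ f ≋ hProduct n (Δ^ n f)
    gPoly-⋆ roots ζ≉1 zero    f zero    = trans (+-identityʳ _) (*-identityˡ _)
    gPoly-⋆ roots ζ≉1 zero    f (suc k) = trans (+-identityʳ _) (*-identityˡ _)
    gPoly-⋆ roots ζ≉1 (suc n) f =
      ≋-trans (blocks-⋆ (ζ n) M (gPoly n) f)
      (≋-trans (λ k → reflexive (≡.cong (λ L → geomMul (ζ n) M L (gPoly n ⋆ f) k) (length-gPoly n)))
      (≋-trans (geomMul-cong (ζ n) M (M ℕ.^ n) (gPoly-⋆ roots ζ≉1 n f))
      (≋-trans (geomMul-root M (M ℕ.^ n) (roots n) (ζ≉1 n) (hProduct n (Δ^ n f)))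
               (⋆-cong (h n) (≋-sym (hProduct-Δ n (Δ^ n f)))))))

  valueAt1-++ : ∀ P Q → valueAt1 (P ++ Q) ≈ valueAt1 P + valueAt1 Q
  valueAt1-++ []      Q = sym (+-identityˡ _)
  valueAt1-++ (a ∷ P) Q = trans (+-congˡ (valueAt1-++ P Q)) (sym (+-assoc _ _ _))

  slopeAt1-++ : ∀ P Q → slopeAt1 (P ++ Q) ≈ slopeAt1 P + fromℕ (length P) * valueAt1 Q + slopeAt1 Q
  slopeAt1-++ []      Q = solve 2 (λ v s → s := :0 :+ :0 :* v :+ s) refl (valueAt1 Q) (slopeAt1 Q)
  slopeAt1-++ (a ∷ P) Q = trans (+-cong (valueAt1-++ P Q) (slopeAt1-++ P Q))
    (solve 5 (λ vp vq sp l sq → (vp :+ vq) :+ (sp :+ l :* vq :+ sq) := (vp :+ sp) :+ (:1 :+ l) :* vq :+ sq)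
           refl (valueAt1 P) (valueAt1 Q) (slopeAt1 P) (fromℕ (length P)) (slopeAt1 Q))

  valueAt1-replicate : ∀ L x → valueAt1 (replicate L x) ≈ fromℕ L * x
  valueAt1-replicate zero    x = sym (zeroˡ x)
  valueAt1-replicate (suc L) x = trans (+-congˡ (valueAt1-replicate L x))
    (solve 2 (λ x l → x :+ l :* x := (:1 :+ l) :* x) refl x (fromℕ L))

  slopeAt1-replicate : ∀ L x → slopeAt1 (replicate L x) ≈ Σ< L fromℕ * x
  slopeAt1-replicate zero    x = sym (zeroˡ x)
  slopeAt1-replicate (suc L) x = trans (+-cong (valueAt1-replicate L x) (slopeAt1-replicate L x))
    (trans (sym (distribʳ _ _ _)) (*-congʳ (+-comm _ _)))

  hPoly-valueAt1 : ∀ ζ n L → valueAt1 (hPoly ζ n L) ≈ fromℕ L * Σ< n (λ j → powerSum ζ (suc j))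
  hPoly-valueAt1 ζ zero    L = sym (zeroʳ _)
  hPoly-valueAt1 ζ (suc n) L = begin
    valueAt1 (hPoly ζ n L ++ replicate L w)                   ≈⟨ valueAt1-++ (hPoly ζ n L) _ ⟩
    valueAt1 (hPoly ζ n L) + valueAt1 (replicate L w)         ≈⟨ +-cong (hPoly-valueAt1 ζ n L) (valueAt1-replicate L w) ⟩
    fromℕ L * Σ< n (λ j → powerSum ζ (suc j)) + fromℕ L * w  ≈⟨ distribˡ _ _ _ ⟨
    fromℕ L * Σ< (suc n) (λ j → powerSum ζ (suc j))          ∎
    where w = powerSum ζ (suc n)

  hPoly-slopeAt1 : ∀ ζ n L → slopeAt1 (hPoly ζ n L) ≈
    Σ< L fromℕ * Σ< n (λ j → powerSum ζ (suc j)) + fromℕ L * fromℕ L * Σ< n (λ j → fromℕ j * powerSum ζ (suc j))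
  hPoly-slopeAt1 ζ zero    L = solve 2 (λ a b → :0 := a :* :0 :+ b :* :0) refl (Σ< L fromℕ) (fromℕ L * fromℕ L)
  hPoly-slopeAt1 ζ (suc n) L = begin
    slopeAt1 (hPoly ζ n L ++ replicate L w)                   ≈⟨ slopeAt1-++ (hPoly ζ n L) _ ⟩
    slopeAt1 (hPoly ζ n L) + fromℕ (length (hPoly ζ n L)) * valueAt1 (replicate L w) + slopeAt1 (replicate L w)
      ≈⟨ +-cong (+-cong (hPoly-slopeAt1 ζ n L)
                        (*-cong (trans (reflexive (≡.cong fromℕ (length-hPoly ζ n L))) (fromℕ-* n L)) (valueAt1-replicate L w)))
                (slopeAt1-replicate L w) ⟩
    (T * X + l * l * Y) + fromℕ n * l * (l * w) + T * w
      ≈⟨ solve 6 (λ T X l Y i w → (T :* X :+ l :* l :* Y) :+ i :* l :* (l :* w) :+ T :* w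
                                  := T :* (X :+ w) :+ l :* l :* (Y :+ i :* w)) refl T X l Y (fromℕ n) w ⟩
    T * Σ< (suc n) (λ j → powerSum ζ (suc j)) + l * l * Σ< (suc n) (λ j → fromℕ j * powerSum ζ (suc j)) ∎
    where
    w = powerSum ζ (suc n)
    T = Σ< L fromℕ
    l = fromℕ L
    X = Σ< n (λ j → powerSum ζ (suc j))
    Y = Σ< n (λ j → fromℕ j * powerSum ζ (suc j))

  Σ<-powerSum : ∀ ζ m → (1# - ζ) * Σ< m (λ j → powerSum ζ (suc j)) ≈ fromℕ m - ζ * powerSum ζ m
  Σ<-powerSum ζ zero    = solve 1 (λ z → (:1 :- z) :* :0 := :0 :- z :* :0) refl ζ
  Σ<-powerSum ζ (suc m) = trans (distribˡ _ _ _) (trans (+-cong (Σ<-powerSum ζ m) (geometric ζ (suc m)))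
    (solve 4 (λ a z w p → (a :- z :* w) :+ (:1 :- z :* p) := (:1 :+ a) :- z :* (w :+ p)) refl (fromℕ m) ζ (powerSum ζ m) (ζ ^ m)))

  Σ<-j*ζ^j : ∀ ζ m → (1# - ζ) * Σ< m (λ j → fromℕ j * ζ ^ j) ≈ powerSum ζ m - 1# - fromℕ m * ζ ^ m + ζ ^ m
  Σ<-j*ζ^j ζ zero    = solve 1 (λ z → (:1 :- z) :* :0 := :0 :- :1 :- :0 :* :1 :+ :1) refl ζ
  Σ<-j*ζ^j ζ (suc m) = trans (distribˡ _ _ _) (trans (+-congʳ (Σ<-j*ζ^j ζ m))
    (solve 4 (λ z w a p → (w :- :1 :- a :* p :+ p) :+ (:1 :- z) :* (a :* p)
                          := (w :+ p) :- :1 :- (:1 :+ a) :* (z :* p) :+ z :* p) refl ζ (powerSum ζ m) (fromℕ m) (ζ ^ m)))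

  Σ<-j*powerSum : ∀ ζ m → (1# - ζ) * Σ< m (λ j → fromℕ j * powerSum ζ (suc j)) ≈
                  Σ< m fromℕ - ζ * Σ< m (λ j → fromℕ j * ζ ^ j)
  Σ<-j*powerSum ζ zero    = solve 1 (λ z → (:1 :- z) :* :0 := :0 :- z :* :0) refl ζ
  Σ<-j*powerSum ζ (suc m) = begin
    (1# - ζ) * (Y + a * powerSum ζ (suc m))              ≈⟨ distribˡ _ _ _ ⟩
    (1# - ζ) * Y + (1# - ζ) * (a * powerSum ζ (suc m))
      ≈⟨ +-cong (Σ<-j*powerSum ζ m) (trans (x*[y*z]≈y*[x*z] _ _ _) (*-congˡ (geometric ζ (suc m)))) ⟩
    (T - ζ * V) + a * (1# - ζ * ζ ^ m)
      ≈⟨ solve 5 (λ t z v a p → (t :- z :* v) :+ a :* (:1 :- z :* p) := (t :+ a) :- z :* (v :+ a :* p)) refl T ζ V a (ζ ^ m) ⟩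
    (T + a) - ζ * (V + a * ζ ^ m)                        ∎
    where
    a = fromℕ m
    Y = Σ< m (λ j → fromℕ j * powerSum ζ (suc j))
    T = Σ< m fromℕ
    V = Σ< m (λ j → fromℕ j * ζ ^ j)
    x*[y*z]≈y*[x*z] : ∀ x y z → x * (y * z) ≈ y * (x * z)
    x*[y*z]≈y*[x*z] = solve 3 (λ x y z → x :* (y :* z) := y :* (x :* z)) refl

  two*Σ<-fromℕ : ∀ n → fromℕ 2 * Σ< n fromℕ ≈ fromℕ n * fromℕ n - fromℕ n
  two*Σ<-fromℕ zero    = solve 0 ((:1 :+ (:1 :+ :0)) :* :0 := :0 :* :0 :- :0) refl
  two*Σ<-fromℕ (suc n) = trans (distribˡ _ _ _) (trans (+-congʳ (two*Σ<-fromℕ n))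
    (solve 1 (λ a → (a :* a :- a) :+ (:1 :+ (:1 :+ :0)) :* a := (:1 :+ a) :* (:1 :+ a) :- (:1 :+ a)) refl (fromℕ n)))

  module RootOfUnity {ζ : Carrier} (M : ℕ) (ζ^M≈1 : ζ ^ M ≈ 1#) (ζ≉1 : ¬ (1# - ζ ≈ 0#)) where

    private
      u i : Carrier
      u = 1# - ζ
      i = u ⁻¹
      m = fromℕ M

      Σ<-powerSum-root : Σ< M (λ j → powerSum ζ (suc j)) ≈ m * i
      Σ<-powerSum-root = u*x≈y⇒x≈y÷u ζ≉1 (trans (Σ<-powerSum ζ M)
             (trans (+-congˡ (-‿cong (*-congˡ (powerSum-root M ζ^M≈1 ζ≉1))))
                    (solve 2 (λ a z → a :- z :* :0 := a) refl m ζ)))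

      Σ<-j*ζ^j-root : Σ< M (λ j → fromℕ j * ζ ^ j) ≈ (- m) * i
      Σ<-j*ζ^j-root = u*x≈y⇒x≈y÷u ζ≉1 (trans (Σ<-j*ζ^j ζ M)
             (trans (+-cong (+-cong (+-congʳ (powerSum-root M ζ^M≈1 ζ≉1)) (-‿cong (*-congˡ ζ^M≈1))) ζ^M≈1)
                    (solve 1 (λ a → :0 :- :1 :- a :* :1 :+ :1 := :- a) refl m)))

      Σ<-j*powerSum-root : Σ< M (λ j → fromℕ j * powerSum ζ (suc j)) ≈ (Σ< M fromℕ - ζ * ((- m) * i)) * i
      Σ<-j*powerSum-root = u*x≈y⇒x≈y÷u ζ≉1 (trans (Σ<-j*powerSum ζ M) (+-congˡ (-‿cong (*-congˡ Σ<-j*ζ^j-root))))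

    hPoly-valueAt1-root : ∀ L → valueAt1 (hPoly ζ M L) ≈ fromℕ (M ℕ.* L) * (1# ÷ u)
    hPoly-valueAt1-root L = begin
      valueAt1 (hPoly ζ M L)         ≈⟨ hPoly-valueAt1 ζ M L ⟩
      fromℕ L * Σ< M (λ j → powerSum ζ (suc j)) ≈⟨ *-congˡ Σ<-powerSum-root ⟩
      fromℕ L * (m * i)              ≈⟨ solve 3 (λ l m i → l :* (m :* i) := m :* l :* (:1 :* i)) refl (fromℕ L) m i ⟩
      m * fromℕ L * (1# * i)         ≈⟨ *-congʳ (fromℕ-* M L) ⟨
      fromℕ (M ℕ.* L) * (1# ÷ u)     ∎

    hPoly-slopeAt1-root : ¬ (fromℕ 2 ≈ 0#) → ∀ L → slopeAt1 (hPoly ζ M L) ≈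
      valueAt1 (hPoly ζ M L) * ((fromℕ (M ℕ.* L) - 1#) ÷ fromℕ 2 + fromℕ L * ζ ÷ u)
    hPoly-slopeAt1-root 2≉0 L = begin
      slopeAt1 (hPoly ζ M L)         ≈⟨ hPoly-slopeAt1 ζ M L ⟩
      Σ< L fromℕ * Σ< M (λ j → powerSum ζ (suc j)) + l * l * Σ< M (λ j → fromℕ j * powerSum ζ (suc j))
        ≈⟨ +-cong (*-cong (triangle L) Σ<-powerSum-root) (*-congˡ (trans Σ<-j*powerSum-root (*-congʳ (+-congʳ (triangle M))))) ⟩
      (l * l - l) * t * (m * i) + l * l * (((m * m - m) * t - ζ * ((- m) * i)) * i)
        ≈⟨ solve 5 (λ l m z i t → (l :* l :- l) :* t :* (m :* i) :+ l :* l :* (((m :* m :- m) :* t :- z :* ((:- m) :* i)) :* i)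
                                  := m :* l :* (:1 :* i) :* ((m :* l :- :1) :* t :+ l :* z :* i)) refl l m ζ i t ⟩
      m * l * (1# * i) * ((m * l - 1#) * t + l * ζ * i)
        ≈⟨ *-cong (trans (*-congʳ (sym (fromℕ-* M L))) (sym (hPoly-valueAt1-root L)))
                  (+-congʳ (*-congʳ (+-congʳ (sym (fromℕ-* M L))))) ⟩
      valueAt1 (hPoly ζ M L) * ((fromℕ (M ℕ.* L) - 1#) ÷ fromℕ 2 + fromℕ L * ζ ÷ u) ∎
      where
      l = fromℕ L
      t = fromℕ 2 ⁻¹
      triangle : ∀ n → Σ< n fromℕ ≈ (fromℕ n * fromℕ n - fromℕ n) * t
      triangle n = u*x≈y⇒x≈y÷u 2≉0 (two*Σ<-fromℕ n)

  Π<-fromℕ-pow : ∀ M n (c : ℕ → Carrier) →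
                 Π< n (λ l → fromℕ (M ℕ.^ suc l) * c l) ≈ fromℕ (M ℕ.^ triangular n) * Π< n c
  Π<-fromℕ-pow M zero    c = solve 0 (:1 := (:1 :+ :0) :* :1) refl
  Π<-fromℕ-pow M (suc n) c = begin
    Π< n (λ l → fromℕ (M ℕ.^ suc l) * c l) * (fromℕ (M ℕ.^ suc n) * c n)
      ≈⟨ *-congʳ (Π<-fromℕ-pow M n c) ⟩
    fromℕ (M ℕ.^ triangular n) * Π< n c * (fromℕ (M ℕ.^ suc n) * c n)
      ≈⟨ solve 4 (λ a p b x → a :* p :* (b :* x) := (a :* b) :* (p :* x)) refl _ _ _ _ ⟩
    (fromℕ (M ℕ.^ triangular n) * fromℕ (M ℕ.^ suc n)) * (Π< n c * c n)
      ≈⟨ *-congʳ (trans (sym (fromℕ-* (M ℕ.^ triangular n) _)) (reflexive (≡.cong fromℕ (≡.sym (ℕₚ.^-distribˡ-+-* M (triangular n) (suc n)))))) ⟩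
    fromℕ (M ℕ.^ triangular (suc n)) * Π< (suc n) c ∎

  module Setting (k N : ℕ) (ξ : Carrier) where
    open BaseShift k N using (M; B-leading-digit)

    ζ : ℕ → Carrier
    ζ l = ξ ^ (N ℕ.^ l)

    open Factorisation M ζ public

    coeff-gPoly : ∀ n m → m < M ℕ.^ n → coeff (gPoly n) m ≈ ξ ^ B M N m
    coeff-gPoly zero    zero    _           = refl
    coeff-gPoly zero    (suc m) (s≤s ())
    coeff-gPoly (suc n) m m<M^1+n = begin
      coeff (gPoly (suc n)) m                     ≡⟨ ≡.cong (coeff (gPoly (suc n))) m≡jL+r ⟩
      coeff (blocks (ζ n) M (gPoly n)) (j ℕ.* length (gPoly n) ℕ.+ r)
        ≈⟨ coeff-blocks (ζ n) M (gPoly n) j<M (≡.subst (r <_) (≡.sym (length-gPoly n)) r<L) ⟩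
      ζ n ^ j * coeff (gPoly n) r                 ≈⟨ *-cong (^-* ξ (N ℕ.^ n) j) (sym (coeff-gPoly n r r<L)) ⟨
      ξ ^ (j ℕ.* N ℕ.^ n) * ξ ^ B M N r           ≈⟨ trans (*-comm _ _) (sym (^-+ ξ (B M N r) _)) ⟩
      ξ ^ (B M N r ℕ.+ j ℕ.* N ℕ.^ n)             ≡⟨ ≡.cong (ξ ^_) (B-leading-digit n r<L j<M) ⟨
      ξ ^ B M N (j ℕ.* L ℕ.+ r)                   ≡⟨ ≡.cong (λ e → ξ ^ B M N e) (m≡jL+r′) ⟨
      ξ ^ B M N m                                 ∎
      where
      L = M ℕ.^ n
      instance _ = ℕ.>-nonZero (ℕₚ.m^n>0 M n)
      j = m / L
      r = m % L
      m≡jL+r′ : m ≡ j ℕ.* L ℕ.+ r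
      m≡jL+r′ = ≡.trans (m≡m%n+[m/n]*n m L) (ℕₚ.+-comm r (j ℕ.* L))
      m≡jL+r : m ≡ j ℕ.* length (gPoly n) ℕ.+ r
      m≡jL+r = ≡.trans m≡jL+r′ (≡.cong (λ e → j ℕ.* e ℕ.+ r) (≡.sym (length-gPoly n)))
      j<M : j < M
      j<M = m<n*o⇒m/o<n m<M^1+n
      r<L : r < L
      r<L = m%n<n m L

    gCoeff≈coeff-gPoly : ∀ p m → gCoeff M N p ξ m ≈ coeff (gPoly (suc p)) m
    gCoeff≈coeff-gPoly p m with m ℕ.<? M ℕ.^ suc p
    ... | yes m<M^1+p = sym (coeff-gPoly (suc p) m m<M^1+p)
    ... | no  m≮M^1+p = sym (coeff-beyond (gPoly (suc p)) m
                              (≡.subst (ℕ._≤ m) (≡.sym (length-gPoly (suc p))) (ℕₚ.≮⇒≥ m≮M^1+p)))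

    β≋gPoly-⋆ : ∀ p → β M N p ξ ≋ gPoly (suc p) ⋆ binomialSeries p
    β≋gPoly-⋆ p k = sym (trans (⋆-cauchy (gPoly (suc p)) (binomialSeries p) k)
                               (Σ<-cong (suc k) (λ m → *-congʳ (sym (gCoeff≈coeff-gPoly p m)))))

    ζ-root : ξ ^ M ≈ 1# → ∀ l → ζ l ^ M ≈ 1#
    ζ-root ξ^M≈1 l = root-pow M ξ^M≈1 (N ℕ.^ l)

    -- ζ_l = 1 would force M ∣ N^l, and then every prime factor of M divides N.
    ζ-nontrivial : PrimitiveRoot M ξ → 1 ≤ N → ¬ (rad M ∣ rad N) → ∀ l → ¬ (1# - ζ l ≈ 0#)
    ζ-nontrivial ξ-primitive N≥1 rad∤ l 1-ζ≈0 =
      rad∤ (Radical.∣^⇒rad∣rad l N≥1 (primitiveRoot-∣ ξ-primitive (N ℕ.^ l) (1-x≈0⇒x≈1 1-ζ≈0)))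

    module _ (roots : ∀ l → ζ l ^ M ≈ 1#) (ζ≉1 : ∀ l → ¬ (1# - ζ l ≈ 0#)) where

      β≋hProduct-δ : ∀ p → β M N p ξ ≋ hProduct (suc p) δ
      β≋hProduct-δ p = ≋-trans (β≋gPoly-⋆ p)
        (≋-trans (gPoly-⋆ roots ζ≉1 (suc p) (binomialSeries p)) (hProduct-cong (suc p) (Δ^-binomialSeries p)))

      h-valueAt1 : ∀ l → valueAt1 (h l) ≈ fromℕ (M ℕ.^ suc l) * (1# ÷ (1# - ζ l))
      h-valueAt1 l = RootOfUnity.hPoly-valueAt1-root M (roots l) (ζ≉1 l) (M ℕ.^ l)

      h-slopeAt1 : ¬ (fromℕ 2 ≈ 0#) → ∀ l → slopeAt1 (h l) ≈ valueAt1 (h l) *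
                   ((fromℕ (M ℕ.^ (l ℕ.+ 1)) - 1#) ÷ fromℕ 2 + fromℕ (M ℕ.^ l) * ζ l ÷ (1# - ζ l))
      h-slopeAt1 2≉0 l = trans (RootOfUnity.hPoly-slopeAt1-root M (roots l) (ζ≉1 l) 2≉0 (M ℕ.^ l))
        (*-congˡ (+-congʳ (*-congʳ (+-congʳ (reflexive (≡.cong (λ e → fromℕ (M ℕ.^ e)) (ℕₚ.+-comm 1 l)))))))

      β-vanishes : ∀ p → VanishesFrom (supportBound (suc p)) (β M N p ξ)
      β-vanishes p k K≤k = trans (β≋hProduct-δ p k) (hProduct-δ-vanishes (suc p) k K≤k)

      Σ<-β : ∀ p → Σ< (supportBound (suc p)) (β M N p ξ) ≈
             fromℕ (M ℕ.^ (((p ℕ.+ 1) ℕ.* (p ℕ.+ 2)) ℕ./ 2)) * Π< (suc p) (λ l → 1# ÷ (1# - ζ l))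
      Σ<-β p = begin
        Σ< K (β M N p ξ)                                            ≈⟨ Σ<-cong K (β≋hProduct-δ p) ⟩
        Σ< K (hProduct (suc p) δ)                                   ≈⟨ Σ<-hProduct-δ (suc p) ⟩
        Π< (suc p) (λ l → valueAt1 (h l))                           ≈⟨ Π<-cong (suc p) h-valueAt1 ⟩
        Π< (suc p) (λ l → fromℕ (M ℕ.^ suc l) * (1# ÷ (1# - ζ l)))  ≈⟨ Π<-fromℕ-pow M (suc p) _ ⟩
        fromℕ (M ℕ.^ triangular (suc p)) * ∏1/[1-ζ]
          ≡⟨ ≡.cong (λ e → fromℕ (M ℕ.^ e) * ∏1/[1-ζ]) (triangular-closed p) ⟩
        fromℕ (M ℕ.^ (((p ℕ.+ 1) ℕ.* (p ℕ.+ 2)) ℕ./ 2)) * ∏1/[1-ζ]  ∎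
        where K = supportBound (suc p)
              ∏1/[1-ζ] = Π< (suc p) (λ l → 1# ÷ (1# - ζ l))

      moment-β : ¬ (fromℕ 2 ≈ 0#) → ∀ p → moment (supportBound (suc p)) (β M N p ξ) ≈
                 Σ< (supportBound (suc p)) (β M N p ξ) * Σ< (suc p) (λ l →
                   (fromℕ (M ℕ.^ (l ℕ.+ 1)) - 1#) ÷ fromℕ 2 + fromℕ (M ℕ.^ l) * ζ l ÷ (1# - ζ l))
      moment-β 2≉0 p = begin
        moment K (β M N p ξ)                      ≈⟨ Σ<-cong K (λ k → *-congˡ (β≋hProduct-δ p k)) ⟩
        moment K (hProduct (suc p) δ)             ≈⟨ moment-hProduct-δ _ (h-slopeAt1 2≉0) (suc p) ⟩
        Σ< K (hProduct (suc p) δ) * Σ< (suc p) _  ≈⟨ *-congʳ (Σ<-cong K (β≋hProduct-δ p)) ⟨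
        Σ< K (β M N p ξ) * Σ< (suc p) _           ∎
        where K = supportBound (suc p)

proposition3p6 : ∀ {c ℓ : Level} (F : Field c ℓ) (M N p : ℕ) →
    2 ≤ M → 1 ≤ N → ¬ (rad M ∣ rad N) →
    FieldDefs.CharZero F →
    (ξ : Field.Carrier F) → FieldDefs.PrimitiveRoot F M ξ →
    let open Field F
        open FieldDefs F
        b = β M N p ξ
    in ∃ λ K →
         (∀ k → K ≤ k → b k ≈ 0#)
       × (Σ< K b ≈ fromℕ (M ℕ.^ (((p ℕ.+ 1) ℕ.* (p ℕ.+ 2)) ℕ./ 2))
                     * Π< (suc p) (λ l → 1# ÷ (1# - ξ ^ (N ℕ.^ l))))
       × (Σ< K (λ k → fromℕ k * b k)
            ≈ Σ< K b * Σ< (suc p) (λ l →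
                  (fromℕ (M ℕ.^ (l ℕ.+ 1)) - 1#) ÷ fromℕ 2
                  + fromℕ (M ℕ.^ l) * (ξ ^ (N ℕ.^ l)) ÷ (1# - ξ ^ (N ℕ.^ l))))
proposition3p6 F (suc (suc k)) N p (ℕ.s≤s (ℕ.s≤s ℕ.z≤n)) N≥1 rad∤ charZero ξ ξ-primitive =
  supportBound (suc p) , β-vanishes roots ζ≉1 p , Σ<-β roots ζ≉1 p , moment-β roots ζ≉1 (charZero 1) p
  where
  open OverField F
  open Setting k N ξ
  roots = ζ-root (proj₁ ξ-primitive)
  ζ≉1   = ζ-nontrivial ξ-primitive N≥1 rad∤
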